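{- Let $F$ be a temporally transitive orientation of a temporal graph $(G,\lambda)$, and let $A$ be a $\Lambda$-implication class of $(G,\lambda)$. Then either $A\subseteq F$ or $A^{ -1}\subseteq F$, and in either case $A\cap A^{ -1}=\emptyset$.
   Context: A temporal graph is a pair $(G,\lambda)$ with $G=(V,E)$ a finite simple undirected graph and $\lambda:E\to\mathbb{N}$. A proper orientation $F$ of $E$ is a set of ordered pairs containing exactly one of $uv$, $vu$ for each $\{u,v\}\in E$; $(uv,t)$ denotes edge $\{u,v\}$ with label $t$ oriented as $uv$. $F$ is temporally transitive if whenever $(uv,t_1)$ and $(vw,t_2)$ are oriented time-edges with $t_2\ge t_1$, there is an oriented time-edge $(uw,t_3)$ with $t_3\ge t_2$. Define the relation $\Lambda$ on oriented edges by: $uv\ \Lambda\ u'v'$ iff $\lambda(u,v)=\lambda(u',v')=t$ and one of: ($u=u'$ and $\{v,v'\}\notin E$), ($v=v'$ and $\{u,u'\}\notin E$), ($u=u'$ and $\lambda(v,v')<t$), ($v=v'$ and $\lambda(u,u')<t$). The equivalence classes of the reflexive transitive closure $\Lambda^*$ are the $\Lambda$-implication classes. $A^{ -1}=\{vu:uv\in A\}$. -}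

module Defs where

open import Level using (0ℓ)
open import Data.Nat using (ℕ; _<_; _≥_)
open import Data.Fin using (Fin)
open import Data.Product using (Σ; _×_; _,_; ∃-syntax)
open import Data.Sum using (_⊎_)
open import Relation.Nullary using (¬_)
open import Relation.Binary.PropositionalEquality using (_≡_)
open import Relation.Binary.Construct.Closure.ReflexiveTransitive using (Star)
open import Function.Bundles using (_⇔_)

-- A temporal graph on the finite vertex set Fin n:
-- a simple undirected graph (symmetric, irreflexive adjacency) together with
-- a labelling λ of its edges by natural numbers. λ is given as a symmetric
-- function on all pairs; only its values on edges are ever used.
record TemporalGraph (n : ℕ) : Set₁ where
  field
    E      : Fin n → Fin n → Set
    E-sym  : ∀ {u v} → E u v → E v u
    E-irr  : ∀ {u} → ¬ E u u
    lab    : Fin n → Fin n → ℕ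
    lab-sym : ∀ u v → lab u v ≡ lab v u

module _ {n : ℕ} (TG : TemporalGraph n) where
  open TemporalGraph TG

  OPair : Set
  OPair = Fin n × Fin n

  flip : OPair → OPair
  flip (u , v) = (v , u)

  OSet : Set₁
  OSet = Fin n → Fin n → Set

  record ProperOrientation (F : OSet) : Set where
    field
      F⊆E    : ∀ {u v} → F u v → E u v
      cover  : ∀ {u v} → E u v → F u v ⊎ F v u
      unique : ∀ {u v} → F u v → ¬ F v u

  TemporallyTransitive : OSet → Set
  TemporallyTransitive F =
    ∀ {u v w} → F u v → F v w → lab v w ≥ lab u v →
      F u w × lab u w ≥ lab v w

  Λ : OPair → OPair → Set
  Λ (u , v) (u' , v') =
    E u v × E u' v' × lab u v ≡ lab u' v' ×
    ( (u ≡ u' × ¬ E v v')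
    ⊎ (v ≡ v' × ¬ E u u')
    ⊎ (u ≡ u' × E v v' × lab v v' < lab u v)
    ⊎ (v ≡ v' × E u u' × lab u u' < lab u v) )

  Λ* : OPair → OPair → Set
  Λ* = Star Λ

  IsImplicationClass : OSet → Set
  IsImplicationClass A =
    Σ OPair (λ { (a , b) → E a b × (∀ u v → A u v ⇔ Λ* (a , b) (u , v)) })

{-# OPTIONS --safe #-}
module Submission where

-- Each basic step uv Λ u'v' forces F to orient u'v' the same way as uv:
-- if F contained the reverse of u'v', the two F-edges through the shared endpoint
-- would form a path with equal labels, and temporal transitivity would produce an
-- edge between the two other endpoints with label at least t, contradicting the
-- side condition of Λ. Since Λ commutes with reversing both pairs, the same holds
-- for F⁻¹, so the whole class lies in F or in F⁻¹ according to how F orients its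
-- representative; antisymmetry of F then separates A from A⁻¹.

open import Defs
open import Data.Nat using (ℕ; _≤_)
open import Data.Nat.Properties using (≤-reflexive; ≤-trans; <-≤-trans; <⇒≱)
open import Data.Product using (_×_; _,_; proj₁; proj₂)
open import Data.Sum using (_⊎_; inj₁; inj₂)
open import Function using (id; _∘_)
open import Function.Bundles using (Equivalence)
open import Relation.Nullary using (¬_; contradiction)
open import Relation.Binary.PropositionalEquality using (_≡_; refl; sym; trans)
open import Relation.Binary.Construct.Closure.ReflexiveTransitive using (fold; gmap)

module _ {n : ℕ} (TG : TemporalGraph n) where
  open TemporalGraph TG

  flip-label : ∀ {u v u' v'} → lab u v ≡ lab u' v' → lab v u ≡ lab v' u'
  flip-label {u} {v} {u'} {v'} eq = trans (lab-sym v u) (trans eq (lab-sym u' v'))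

  Λ-flip : ∀ {p q} → Λ TG p q → Λ TG (flip TG p) (flip TG q)
  Λ-flip (Euv , Eu'v' , eq , inj₁ tail) =
    E-sym Euv , E-sym Eu'v' , flip-label eq , inj₂ (inj₁ tail)
  Λ-flip (Euv , Eu'v' , eq , inj₂ (inj₁ head)) =
    E-sym Euv , E-sym Eu'v' , flip-label eq , inj₁ head
  Λ-flip {u , v} (Euv , Eu'v' , eq , inj₂ (inj₂ (inj₁ (u≡u' , Evv' , lt)))) =
    E-sym Euv , E-sym Eu'v' , flip-label eq ,
    inj₂ (inj₂ (inj₂ (u≡u' , Evv' , <-≤-trans lt (≤-reflexive (lab-sym u v)))))
  Λ-flip {u , v} (Euv , Eu'v' , eq , inj₂ (inj₂ (inj₂ (v≡v' , Euu' , lt)))) =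
    E-sym Euv , E-sym Eu'v' , flip-label eq ,
    inj₂ (inj₂ (inj₁ (v≡v' , Euu' , <-≤-trans lt (≤-reflexive (lab-sym u v)))))

  Λ*-flip : ∀ {p q} → Λ* TG p q → Λ* TG (flip TG p) (flip TG q)
  Λ*-flip = gmap (flip TG) Λ-flip

module _ {n : ℕ} {TG : TemporalGraph n} {F : OSet TG}
         (PO : ProperOrientation TG F) (TT : TemporallyTransitive TG F) where
  open TemporalGraph TG
  open ProperOrientation PO

  Oriented : OPair TG → Set
  Oriented (u , v) = F u v

  oriented-unless-reversed : ∀ {u v} → E u v → ¬ F v u → F u v
  oriented-unless-reversed Euv ¬Fvu with cover Euv
  ... | inj₁ Fuv = Fuv
  ... | inj₂ Fvu = contradiction Fvu ¬Fvu

  equal-label-shortcut : ∀ {x y z} → F x y → F y z → lab x y ≡ lab y z →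
                         E x z × lab y z ≤ lab x z
  equal-label-shortcut Fxy Fyz eq = let Fxz , ge = TT Fxy Fyz (≤-reflexive eq) in F⊆E Fxz , ge

  reversed-at-tail : ∀ {u v v'} → F u v → F v' u → lab u v ≡ lab u v' →
                     E v v' × lab u v ≤ lab v v'
  reversed-at-tail {u} {v} {v'} Fuv Fv'u eq =
    let Ev'v , ge = equal-label-shortcut Fv'u Fuv (trans (lab-sym v' u) (sym eq))
    in E-sym Ev'v , ≤-trans ge (≤-reflexive (lab-sym v' v))

  reversed-at-head : ∀ {u v u'} → F u v → F v u' → lab u v ≡ lab u' v →
                     E u u' × lab u v ≤ lab u u'
  reversed-at-head {u} {v} {u'} Fuv Fvu' eq =
    let path-eq = trans eq (lab-sym u' v)
        Euu' , ge = equal-label-shortcut Fuv Fvu' path-eq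
    in Euu' , ≤-trans (≤-reflexive path-eq) ge

  Λ-preserves-orientation : ∀ {p q} → Λ TG p q → Oriented p → Oriented q
  Λ-preserves-orientation (_ , Euv' , eq , inj₁ (refl , ¬Evv')) Fuv =
    oriented-unless-reversed Euv' λ Fv'u → ¬Evv' (proj₁ (reversed-at-tail Fuv Fv'u eq))
  Λ-preserves-orientation (_ , Eu'v , eq , inj₂ (inj₁ (refl , ¬Euu'))) Fuv =
    oriented-unless-reversed Eu'v λ Fvu' → ¬Euu' (proj₁ (reversed-at-head Fuv Fvu' eq))
  Λ-preserves-orientation (_ , Euv' , eq , inj₂ (inj₂ (inj₁ (refl , _ , lt)))) Fuv =
    oriented-unless-reversed Euv' λ Fv'u → <⇒≱ lt (proj₂ (reversed-at-tail Fuv Fv'u eq))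
  Λ-preserves-orientation (_ , Eu'v , eq , inj₂ (inj₂ (inj₂ (refl , _ , lt)))) Fuv =
    oriented-unless-reversed Eu'v λ Fvu' → <⇒≱ lt (proj₂ (reversed-at-head Fuv Fvu' eq))

  Λ*-preserves-orientation : ∀ {p q} → Λ* TG p q → Oriented p → Oriented q
  Λ*-preserves-orientation =
    fold (λ p q → Oriented p → Oriented q) (λ step rest → rest ∘ Λ-preserves-orientation step) id

  Λ*-preserves-reverse-orientation : ∀ {p q} → Λ* TG p q →
                                     Oriented (flip TG p) → Oriented (flip TG q)
  Λ*-preserves-reverse-orientation = Λ*-preserves-orientation ∘ Λ*-flip TG

inclusion⇒disjoint-inverse : ∀ {n} {TG : TemporalGraph n} {F A : OSet TG} →
                             ProperOrientation TG F →
                             (∀ u v → A u v → F u v) ⊎ (∀ u v → A u v → F v u) →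
                             ∀ u v → A u v → ¬ A v u
inclusion⇒disjoint-inverse PO (inj₁ A⊆F)  u v Auv Avu =
  ProperOrientation.unique PO (A⊆F u v Auv) (A⊆F v u Avu)
inclusion⇒disjoint-inverse PO (inj₂ A⊆F⁻) u v Auv Avu =
  ProperOrientation.unique PO (A⊆F⁻ v u Avu) (A⊆F⁻ u v Auv)

lemma3p4 : (n : ℕ) (TG : TemporalGraph n) (F : OSet TG) (A : OSet TG) →
           ProperOrientation TG F → TemporallyTransitive TG F →
           IsImplicationClass TG A →
           ((∀ u v → A u v → F u v) ⊎ (∀ u v → A u v → F v u))
           × (∀ u v → A u v → ¬ A v u)
lemma3p4 n TG F A PO TT ((a , b) , Eab , A≡class) =
  inclusion , inclusion⇒disjoint-inverse PO inclusion
  where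
  from-rep : ∀ u v → A u v → Λ* TG (a , b) (u , v)
  from-rep u v = Equivalence.to (A≡class u v)

  inclusion : (∀ u v → A u v → F u v) ⊎ (∀ u v → A u v → F v u)
  inclusion with ProperOrientation.cover PO Eab
  ... | inj₁ Fab = inj₁ λ u v Auv → Λ*-preserves-orientation PO TT (from-rep u v Auv) Fab
  ... | inj₂ Fba = inj₂ λ u v Auv → Λ*-preserves-reverse-orientation PO TT (from-rep u v Auv) Fba
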